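{- Let $r\ge 1$ and $n\ge 1$ be integers and $0\le k\le n$. The number $A_{n,k}^{(r)}$ of $r$-colored Dyck paths of length $2n$ having exactly $k$ occurrences of two consecutive $\mathbf{d}$-steps with the same color is $$A_{n,k}^{(r)}=\sum_{\ell=1}^{n-k}\frac{1}{n}\binom{n}{\ell-1}\binom{n}{\ell}\binom{n-\ell}{k}r^{\ell}(r-1)^{n-\ell-k}.$$ In particular, the number $A_{n,0}^{(r)}$ of $r$-colored Dyck paths of length $2n$ with no two consecutive $\mathbf{d}$-steps having the same color equals $S_n(1,r-1)$, and for $r=2$ it equals the large Schröder number $S_n=S_n(1,1)$.
   Context: A Dyck path of length $2n$ is a lattice path from $(0,0)$ to $(2n,0)$ staying weakly above the $x$-axis, using $n$ up-steps $\mathbf{u}=(1,1)$ and $n$ down-steps $\mathbf{d}=(1,-1)$. An $r$-colored Dyck path is a Dyck path in which each $\mathbf{d}$-step is assigned one of the colors in $[r]=\{1,\dots,r\}$. A "$\mathbf{dd}$-step with the same color" is a pair of consecutive steps both of which are $\mathbf{d}$-steps and which carry the same color. For parameters $a,b$, $S_n(a,b)=\sum_{k=0}^{n}\binom{n+k}{2k}C_k a^{n-k}b^{k}$, where $C_k=\frac{1}{k+1}\binom{2k}{k}$ is the Catalan number (the total weight of Schröder paths of length $2n$ with horizontal steps weighted $a$ and down steps weighted $b$). -}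

module Defs where

open import Data.Nat using (ℕ; zero; suc; _+_; _*_; _∸_; _^_; _/_; _≡ᵇ_)
open import Data.Nat.Combinatorics using (_C_)
open import Data.Fin using (Fin; _≟_)
open import Data.Bool using (Bool; true; false; _∧_)
open import Data.List using (List; []; _∷_; map; concatMap; filterᵇ; length; applyUpTo; upTo; allFin)
open import Data.Nat.ListAction using (sum)
open import Relation.Nullary.Decidable using (yes; no)
open import Relation.Binary.PropositionalEquality using (_≡_)

data Step (r : ℕ) : Set where
  u : Step r
  d : Fin r → Step r

allWords : (r m : ℕ) → List (List (Step r))
allWords r zero = [] ∷ []
allWords r (suc m) =
  concatMap (λ w → (u ∷ w) ∷ map (λ c → d c ∷ w) (allFin r)) (allWords r m)

dyckFrom : {r : ℕ} → ℕ → List (Step r) → Bool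
dyckFrom h [] = h ≡ᵇ 0
dyckFrom h (u ∷ w) = dyckFrom (suc h) w
dyckFrom zero (d _ ∷ w) = false
dyckFrom (suc h) (d _ ∷ w) = dyckFrom h w

isDyck : {r : ℕ} → List (Step r) → Bool
isDyck = dyckFrom 0

ddSameAfter : {r : ℕ} → Step r → List (Step r) → ℕ
ddSameAfter p [] = 0
ddSameAfter (d c) (d c' ∷ w) with c ≟ c'
... | yes _ = suc (ddSameAfter (d c') w)
... | no _ = ddSameAfter (d c') w
ddSameAfter (d c) (u ∷ w) = ddSameAfter u w
ddSameAfter u (s ∷ w) = ddSameAfter s w

ddSame : {r : ℕ} → List (Step r) → ℕ
ddSame [] = 0
ddSame (s ∷ w) = ddSameAfter s w

A : (r n k : ℕ) → ℕ
A r n k = length (filterᵇ (λ w → isDyck w ∧ (ddSame w ≡ᵇ k))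
                         (allWords r (2 * n)))

catalan : ℕ → ℕ
catalan k = ((2 * k) C k) / suc k

S : ℕ → ℕ → ℕ → ℕ
S n a b = sum (map (λ k → ((n + k) C (2 * k)) * catalan k * a ^ (n ∸ k) * b ^ k) (upTo (suc n)))

-- n · A^{(r)}_{n,k} as given by the formula (the factor 1/n cleared):
-- Σ_{ℓ=1}^{n-k} binom(n,ℓ-1) binom(n,ℓ) binom(n-ℓ,k) r^ℓ (r-1)^{n-ℓ-k}
nTimesFormula : (r n k : ℕ) → ℕ
nTimesFormula r n k =
  sum (map (λ ℓ → (n C (ℓ ∸ 1)) * (n C ℓ) * ((n ∸ ℓ) C k) * r ^ ℓ * (r ∸ 1) ^ (n ∸ ℓ ∸ k))
           (applyUpTo suc (n ∸ k)))

{-# OPTIONS --safe #-}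

-- Read step by step, the number of ways to finish a coloured Dyck path from height h with m steps
-- left, given whether the previous step went down, obeys a linear recurrence; so do uncoloured Dyck
-- paths counted by peaks and Schröder paths counted by down-steps, and a change of statistic that
-- commutes with the down-steps carries one recurrence into another.  A Dyck path with ℓ peaks has ℓ
-- down-steps after an up-step, coloured freely, while each of the other n − ℓ repeats the colour
-- before it or not: this gives the weight binom(n−ℓ,k) r^ℓ (r−1)^(n−ℓ−k), and a reflection formula
-- valid at every height counts the Dyck paths with ℓ peaks by the Narayana number
-- (1/n) binom(n,ℓ−1) binom(n,ℓ).  For k = 0, writing r = 1 + (r − 1) turns each peak into a flat
-- step or a marked down-step, so the count becomes a sum over Schröder paths weighted by (r − 1) to
-- the number of down-steps, and a trinomial reflection formula counts those with e down-steps as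
-- binom(n+e,2e) C_e.
module Submission where

open import Defs
open import Data.Nat using (ℕ; zero; suc; pred; _+_; _*_; _∸_; _^_; _/_; _≤_; _<_; z≤n; s≤s; _≤?_; _≡ᵇ_)
open import Data.Nat.Properties hiding (_≟_)
open import Data.Nat.Combinatorics using (_C_; nCk+nC[k+1]≡[n+1]C[k+1]; k>n⇒nCk≡0; nC1≡n; nCn≡1; nCk≡nC[n∸k])
open import Data.Nat.DivMod using (m*n/n≡m)
import Data.Nat.ListAction as List
open import Data.Fin using (Fin; zero; suc; toℕ; inject₁; fromℕ; punchIn; _≟_)
open import Data.Fin.Properties using (punchInᵢ≢i; toℕ-fromℕ; toℕ-inject₁; toℕ<n; toℕ≤pred[n])
open import Data.List using (List; []; _∷_; _++_; map; concatMap; filterᵇ; length; applyUpTo; allFin; tabulate)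
open import Data.List.Properties using (filter-++; length-++; map-tabulate)
open import Data.Bool using (Bool; true; false; _∧_; T?)
open import Data.Bool.Properties using (∧-zeroʳ)
open import Data.Product using (_×_; _,_)
open import Function using (_∘_; id)
open import Relation.Nullary using (yes; no; contradiction)
open import Relation.Binary.PropositionalEquality
open import Algebra.Properties.Semiring.Sum +-*-semiring
  using (sum-syntax; sum⁺-syntax; sum-cong-≗; ∑-distrib-+; *-distribˡ-sum; sum-init-last; sum-remove)
open import Algebra.Properties.CommutativeSemigroup +-commutativeSemigroup using (interchange)
open import Algebra.Properties.CommutativeSemigroup *-commutativeSemigroup using (x∙yz≈y∙xz)
open import Data.Nat.Solver using (module +-*-Solver)
open +-*-Solver using (solve; _:+_; _:*_; _:=_; con)

m+1≡1+m+0 : ∀ m → m + 1 ≡ suc m + 0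
m+1≡1+m+0 m = trans (+-comm m 1) (sym (+-identityʳ (suc m)))

n+n≡2*n+0 : ∀ n → n + n ≡ 2 * n + 0
n+n≡2*n+0 n = trans (cong (n +_) (sym (+-identityʳ n))) (sym (+-identityʳ _))

n∸k≤j⇒n∸[1+j]<k : ∀ n k j → n ∸ k ≤ j → j < n → n ∸ suc j < k
n∸k≤j⇒n∸[1+j]<k n zero    j n≤j   j<n = contradiction (≤-trans j<n n≤j) (<-irrefl refl)
n∸k≤j⇒n∸[1+j]<k n (suc k) j n∸k≤j _   = s≤s (m≤n+o⇒m∸n≤o n (suc j)
  (≤-trans (m≤n+m∸n n (suc k)) (≤-trans (+-monoʳ-≤ (suc k) n∸k≤j) (≤-reflexive (cong suc (+-comm k j))))))

∑-const : ∀ n {f : Fin n → ℕ} {v} → (∀ i → f i ≡ v) → ∑[ i < n ] f i ≡ n * v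
∑-const zero    f≡v = refl
∑-const (suc n) f≡v = cong₂ _+_ (f≡v zero) (∑-const n (f≡v ∘ suc))

∑-zero : ∀ n {f : Fin n → ℕ} → (∀ i → f i ≡ 0) → ∑[ i < n ] f i ≡ 0
∑-zero n f≡0 = trans (∑-const n f≡0) (*-zeroʳ n)

∑-except : ∀ {n} (f : Fin (suc n) → ℕ) i {v} → (∀ j → j ≢ i → f j ≡ v) →
           ∑[ j < suc n ] f j ≡ f i + n * v
∑-except f i f≡v =
  trans (sum-remove {i = i} f) (cong (f i +_) (∑-const _ λ j → f≡v (punchIn i j) (punchInᵢ≢i i j)))

∑-dropLast : ∀ n (f : ℕ → ℕ) → f (suc n) ≡ 0 → ∑[ i ≤ suc n ] f (toℕ i) ≡ ∑[ i ≤ n ] f (toℕ i)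
∑-dropLast n f f[1+n]≡0 = begin
  ∑[ i ≤ suc n ] f (toℕ i)
    ≡⟨ sum-init-last (f ∘ toℕ) ⟩
  ∑[ i ≤ n ] f (toℕ (inject₁ i)) + f (toℕ (fromℕ (suc n)))
    ≡⟨ cong₂ _+_ (sum-cong-≗ {suc n} (cong f ∘ toℕ-inject₁)) (trans (cong f (toℕ-fromℕ _)) f[1+n]≡0) ⟩
  ∑[ i ≤ n ] f (toℕ i) + 0
    ≡⟨ +-identityʳ _ ⟩
  ∑[ i ≤ n ] f (toℕ i) ∎
  where open ≡-Reasoning

∑-truncate : ∀ {m n} (f : ℕ → ℕ) → m ≤ n → (∀ i → m ≤ i → i < n → f i ≡ 0) →
             ∑[ i < n ] f (toℕ i) ≡ ∑[ i < m ] f (toℕ i)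
∑-truncate {zero}  {n}     f _         vanish = ∑-zero n λ i → vanish (toℕ i) z≤n (toℕ<n i)
∑-truncate {suc m} {suc n} f (s≤s m≤n) vanish =
  cong (f 0 +_) (∑-truncate (f ∘ suc) m≤n λ i m≤i i<n → vanish (suc i) (s≤s m≤i) (s≤s i<n))

∑-scale : ∀ {n} a (g f : Fin n → ℕ) → a * ∑[ j < n ] (g j * f j) ≡ ∑[ j < n ] (g j * (a * f j))
∑-scale {n} a g f =
  trans (*-distribˡ-sum a (λ j → g j * f j)) (sum-cong-≗ {n} λ j → x∙yz≈y∙xz a (g j) (f j))

∑-factorˡ : ∀ {n} (g f f′ : Fin n → ℕ) →
            ∑[ j < n ] (g j * f j) + ∑[ j < n ] (g j * f′ j) ≡ ∑[ j < n ] (g j * (f j + f′ j))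
∑-factorˡ {n} g f f′ = trans (sym (∑-distrib-+ (λ j → g j * f j) (λ j → g j * f′ j)))
                             (sum-cong-≗ {n} λ j → sym (*-distribˡ-+ (g j) (f j) (f′ j)))

∑-factorʳ : ∀ {n} (g f f′ : Fin n → ℕ) →
            ∑[ j < n ] (f j * g j) + ∑[ j < n ] (f′ j * g j) ≡ ∑[ j < n ] ((f j + f′ j) * g j)
∑-factorʳ {n} g f f′ = trans (sym (∑-distrib-+ (λ j → f j * g j) (λ j → f′ j * g j)))
                             (sum-cong-≗ {n} λ j → sym (*-distribʳ-+ (g j) (f j) (f′ j)))

sum-map-applyUpTo : ∀ (g f : ℕ → ℕ) n → List.sum (map g (applyUpTo f n)) ≡ ∑[ i < n ] g (f (toℕ i))
sum-map-applyUpTo g f zero    = refl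
sum-map-applyUpTo g f (suc n) = cong (g (f 0) +_) (sum-map-applyUpTo g (f ∘ suc) n)

χ : Bool → ℕ
χ true  = 1
χ false = 0

module _ {A : Set} where

  count : (A → Bool) → List A → ℕ
  count p xs = length (filterᵇ p xs)

  count-∷ : ∀ p x xs → count p (x ∷ xs) ≡ χ (p x) + count p xs
  count-∷ p x xs with p x
  ... | true  = refl
  ... | false = refl

  count-++ : ∀ p xs ys → count p (xs ++ ys) ≡ count p xs + count p ys
  count-++ p xs ys = trans (cong length (filter-++ (T? ∘ p) xs ys)) (length-++ (filterᵇ p xs))

  count-cong : ∀ {p q} → (∀ x → p x ≡ q x) → ∀ xs → count p xs ≡ count q xs
  count-cong p≗q []       = refl
  count-cong {p} {q} p≗q (x ∷ xs) = begin
    count p (x ∷ xs)       ≡⟨ count-∷ p x xs ⟩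
    χ (p x) + count p xs   ≡⟨ cong₂ _+_ (cong χ (p≗q x)) (count-cong p≗q xs) ⟩
    χ (q x) + count q xs   ≡⟨ count-∷ q x xs ⟨
    count q (x ∷ xs)       ∎
    where open ≡-Reasoning

  count-none : ∀ xs → count (λ _ → false) xs ≡ 0
  count-none []       = refl
  count-none (x ∷ xs) = count-none xs

  count-tabulate : ∀ p {n} (f : Fin n → A) → count p (tabulate f) ≡ ∑[ i < n ] χ (p (f i))
  count-tabulate p {zero}  f = refl
  count-tabulate p {suc n} f = trans (count-∷ p _ _) (cong (χ (p (f zero)) +_) (count-tabulate p (f ∘ suc)))

shift : (ℕ → ℕ) → ℕ → ℕ
shift f zero    = 0
shift f (suc j) = f j

pascal : ∀ n k → suc n C suc k ≡ n C k + n C suc k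
pascal n k = sym (nCk+nC[k+1]≡[n+1]C[k+1] n k)

[1+k]*[1+n]C[1+k]≡[1+n]*nCk : ∀ n k → suc k * (suc n C suc k) ≡ suc n * (n C k)
[1+k]*[1+n]C[1+k]≡[1+n]*nCk zero    zero    = refl
[1+k]*[1+n]C[1+k]≡[1+n]*nCk zero    (suc k) = *-zeroʳ (2 + k)
[1+k]*[1+n]C[1+k]≡[1+n]*nCk (suc n) zero    =
  trans (+-identityʳ _) (trans (nC1≡n (2 + n)) (sym (*-identityʳ (2 + n))))
[1+k]*[1+n]C[1+k]≡[1+n]*nCk (suc n) (suc k) = begin
  (2 + k) * ((2 + n) C (2 + k))                   ≡⟨ cong ((2 + k) *_) (pascal (suc n) (suc k)) ⟩
  (2 + k) * (c₁ + c₂)                             ≡⟨ solve 3 (λ k c₁ c₂ → (con 2 :+ k) :* (c₁ :+ c₂)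
                                                               := c₁ :+ ((con 1 :+ k) :* c₁ :+ (con 2 :+ k) :* c₂))
                                                             refl k c₁ c₂ ⟩
  c₁ + ((1 + k) * c₁ + (2 + k) * c₂)              ≡⟨ cong (c₁ +_) (cong₂ _+_ ([1+k]*[1+n]C[1+k]≡[1+n]*nCk n k)
                                                                             ([1+k]*[1+n]C[1+k]≡[1+n]*nCk n (suc k))) ⟩
  c₁ + ((1 + n) * (n C k) + (1 + n) * (n C suc k)) ≡⟨ cong (c₁ +_) (*-distribˡ-+ (1 + n) (n C k) (n C suc k)) ⟨
  c₁ + (1 + n) * ((n C k) + (n C suc k))          ≡⟨ cong (λ c → c₁ + (1 + n) * c) (pascal n k) ⟨
  (2 + n) * c₁                                    ∎
  where
  open ≡-Reasoning
  c₁ c₂ : ℕ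
  c₁ = (1 + n) C (1 + k)
  c₂ = (1 + n) C (2 + k)

nC[1+k]*x^[n∸k]≡x*nC[1+k]*x^[n∸1+k] : ∀ n k x →
  (n C suc k) * x ^ (n ∸ k) ≡ x * ((n C suc k) * x ^ (n ∸ suc k))
nC[1+k]*x^[n∸k]≡x*nC[1+k]*x^[n∸1+k] n k x with suc k ≤? n
... | yes k<n = trans (cong (λ e → (n C suc k) * x ^ e) (+-∸-assoc 1 k<n)) (x∙yz≈y∙xz (n C suc k) x _)
... | no k≮n rewrite k>n⇒nCk≡0 (≰⇒> k≮n) = sym (*-zeroʳ x)

catalan≡ : ∀ e → catalan e ≡ ((2 * e) C e) ∸ ((2 * e) C suc e)
catalan≡ e = trans (cong (_/ suc e) (sym [X∸Y]*[1+e]≡X)) (m*n/n≡m (X ∸ Y) (suc e))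
  where
  open ≡-Reasoning
  X Y : ℕ
  X = (2 * e) C e
  Y = (2 * e) C suc e
  [1+e]*Y≡e*X : suc e * Y ≡ e * X
  [1+e]*Y≡e*X = +-cancelˡ-≡ (suc e * X) _ _ (begin
    suc e * X + suc e * Y          ≡⟨ *-distribˡ-+ (suc e) X Y ⟨
    suc e * (X + Y)                ≡⟨ cong (suc e *_) (pascal (2 * e) e) ⟨
    suc e * (suc (2 * e) C suc e)  ≡⟨ [1+k]*[1+n]C[1+k]≡[1+n]*nCk (2 * e) e ⟩
    suc (2 * e) * X                ≡⟨ solve 2 (λ e X → (con 1 :+ (e :+ (e :+ con 0))) :* X := (con 1 :+ e) :* X :+ e :* X)
                                             refl e X ⟩
    suc e * X + e * X              ∎)
  [X∸Y]*[1+e]≡X : (X ∸ Y) * suc e ≡ X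
  [X∸Y]*[1+e]≡X = begin
    (X ∸ Y) * suc e                ≡⟨ *-distribʳ-∸ (suc e) X Y ⟩
    X * suc e ∸ Y * suc e          ≡⟨ cong₂ _∸_ (solve 2 (λ e X → X :* (con 1 :+ e) := e :* X :+ X) refl e X)
                                               (trans (*-comm Y (suc e)) [1+e]*Y≡e*X) ⟩
    e * X + X ∸ e * X              ≡⟨ m+n∸m≡n (e * X) X ⟩
    X                              ∎

trinomial : ℕ → ℕ → ℕ → ℕ
trinomial e i a = ((e + i + a) C i) * ((e + a) C e)

trinomial-sym : ∀ e i a → trinomial e i a ≡ trinomial a i e
trinomial-sym e i a = cong₂ _*_
  (cong (_C i) (solve 3 (λ e i a → e :+ i :+ a := a :+ i :+ e) refl e i a))
  (trans (nCk≡nC[n∸k] (m≤m+n e a)) (trans (cong ((e + a) C_) (m+n∸m≡n e a)) (cong (_C a) (+-comm e a))))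

binomial-pascal : ∀ e a → 0 < e + a →
  (e + a) C e ≡ shift (λ a → (e + a) C e) a + shift (λ e → (e + a) C e) e
binomial-pascal zero    (suc a) _ = refl
binomial-pascal (suc e) zero    _ = begin
  (suc e + 0) C suc e   ≡⟨ cong (_C suc e) (+-identityʳ (suc e)) ⟩
  suc e C suc e         ≡⟨ trans (nCn≡1 (suc e)) (sym (nCn≡1 e)) ⟩
  e C e                 ≡⟨ cong (_C e) (+-identityʳ e) ⟨
  (e + 0) C e           ∎
  where open ≡-Reasoning
binomial-pascal (suc e) (suc a) _ = begin
  suc (e + suc a) C suc e                       ≡⟨ pascal (e + suc a) e ⟩
  (e + suc a) C e + (e + suc a) C suc e         ≡⟨ +-comm ((e + suc a) C e) _ ⟩
  (e + suc a) C suc e + (e + suc a) C e         ≡⟨ cong (λ n → n C suc e + (e + suc a) C e) (+-suc e a) ⟩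
  suc (e + a) C suc e + (e + suc a) C e         ∎
  where open ≡-Reasoning

binomial-pascal′ : ∀ e i a {N} → e + i + a ≡ suc N →
  (N C i) * ((e + a) C e) ≡ (N C i) * (shift (λ a → (e + a) C e) a + shift (λ e → (e + a) C e) e)
binomial-pascal′ zero    i zero    {N} i+0≡1+N = trans (cong (_* 1) NCi≡0) (cong (_* 0) (sym NCi≡0))
  where
  NCi≡0 : N C i ≡ 0
  NCi≡0 = k>n⇒nCk≡0 (≤-reflexive (sym (trans (sym (+-identityʳ i)) i+0≡1+N)))
binomial-pascal′ zero    i (suc a) {N} _ = cong ((N C i) *_) (binomial-pascal zero (suc a) (s≤s z≤n))
binomial-pascal′ (suc e) i a       {N} _ = cong ((N C i) *_) (binomial-pascal (suc e) a (s≤s z≤n))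

trinomial-up : ∀ e i a {N} → e + i + a ≡ suc N →
  shift (trinomial e i) a ≡ (N C i) * shift (λ a → (e + a) C e) a
trinomial-up e i zero    {N} _  = sym (*-zeroʳ (N C i))
trinomial-up e i (suc a)     eq =
  cong (λ n → (n C i) * ((e + a) C e)) (suc-injective (trans (sym (+-suc (e + i) a)) eq))

trinomial-down : ∀ e i a {N} → e + i + a ≡ suc N →
  shift (λ e → trinomial e i a) e ≡ (N C i) * shift (λ e → (e + a) C e) e
trinomial-down zero    i a {N} _  = sym (*-zeroʳ (N C i))
trinomial-down (suc e) i a     eq = cong (λ n → (n C i) * ((e + a) C e)) (suc-injective eq)

trinomial-flat : ∀ e i a {N} → e + i + a ≡ suc N →
  shift (λ i → trinomial e i a) i ≡ shift (N C_) i * ((e + a) C e)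
trinomial-flat e zero    a _  = refl
trinomial-flat e (suc i) a eq =
  cong (λ n → (n C i) * ((e + a) C e)) (suc-injective (trans (cong (_+ a) (sym (+-suc e i))) eq))

trinomial-pascal : ∀ e i a {N} → e + i + a ≡ suc N →
  trinomial e i a ≡ shift (trinomial e i) a + shift (λ i → trinomial e i a) i + shift (λ e → trinomial e i a) e
trinomial-pascal e i a {N} eq = begin
  ((e + i + a) C i) * B                    ≡⟨ cong (λ n → (n C i) * B) eq ⟩
  (suc N C i) * B                          ≡⟨ cong (_* B) (split i) ⟩
  ((N C i) + F) * B                        ≡⟨ *-distribʳ-+ B (N C i) F ⟩
  (N C i) * B + F * B                      ≡⟨ cong (_+ F * B) (binomial-pascal′ e i a eq) ⟩
  (N C i) * (Bₐ + Bₑ) + F * B              ≡⟨ solve 4 (λ c u d h → c :* (u :+ d) :+ h := c :* u :+ h :+ c :* d)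
                                                        refl (N C i) Bₐ Bₑ (F * B) ⟩
  (N C i) * Bₐ + F * B + (N C i) * Bₑ      ≡⟨ cong₂ (λ x y → x + F * B + y) (trinomial-up e i a eq)
                                                                               (trinomial-down e i a eq) ⟨
  shift (trinomial e i) a + F * B + shift (λ e → trinomial e i a) e
    ≡⟨ cong (λ x → shift (trinomial e i) a + x + shift (λ e → trinomial e i a) e) (trinomial-flat e i a eq) ⟨
  shift (trinomial e i) a + shift (λ i → trinomial e i a) i + shift (λ e → trinomial e i a) e ∎
  where
  open ≡-Reasoning
  B Bₐ Bₑ F : ℕ
  B = (e + a) C e
  Bₐ = shift (λ a → (e + a) C e) a
  Bₑ = shift (λ e → (e + a) C e) e
  F = shift (N C_) i
  split : ∀ i → suc N C i ≡ N C i + shift (N C_) i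
  split zero    = refl
  split (suc i) = trans (pascal N i) (+-comm (N C i) (N C suc i))

-- Lattice paths counted by a statistic

data Last : Set where
  up down : Last

emptyPath : ℕ → ℕ → ℕ
emptyPath h       (suc j) = 0
emptyPath zero    zero    = 1
emptyPath (suc h) zero    = 0

emptyPath-off : ∀ h j → emptyPath (suc h) j ≡ 0
emptyPath-off h zero    = refl
emptyPath-off h (suc j) = refl

DownStep : Set
DownStep = Last → (ℕ → ℕ) → ℕ → ℕ

-- walks D last h m j is the weighted number of ways to continue, with m more steps, a path now at
-- height h whose last step was of kind last, so that it ends at height 0 with statistic j.  A
-- down-step acts on the whole distribution of the statistic: D last g is the distribution for a
-- down-step taken now when g is that of the completions after it; up-steps leave it unchanged.
walks : DownStep → Last → ℕ → ℕ → ℕ → ℕ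
walks D last h       zero    j = emptyPath h j
walks D last zero    (suc m) j = walks D up 1 m j
walks D last (suc h) (suc m) j = walks D up (2 + h) m j + D last (walks D down h m) j

RaisesByAtMostOne : DownStep → Set
RaisesByAtMostOne D =
  ∀ last g y → (∀ j → y < j → g j ≡ 0) → ∀ j → suc y < j → D last g j ≡ 0

walks-vanish : ∀ {D} → RaisesByAtMostOne D →
               ∀ m last h y → m + h ≤ y + y → ∀ j → y < j → walks D last h m j ≡ 0
walks-vanish D↑ zero    last h       y       _  (suc j) _   = refl
walks-vanish D↑ (suc m) last zero    y       le j       y<j =
  walks-vanish D↑ m up 1 y (≤-trans (≤-reflexive (m+1≡1+m+0 m)) le) j y<j
walks-vanish D↑ (suc m) last (suc h) zero    () j       y<j
walks-vanish D↑ (suc m) last (suc h) (suc y) le j       y<j = cong₂ _+_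
  (walks-vanish D↑ m up (2 + h) (suc y) (≤-trans (≤-reflexive (+-suc m (suc h))) le) j y<j)
  (D↑ last _ y (walks-vanish D↑ m down h y (≤-pred (≤-pred m+h+2≤y+y+2))) j y<j)
  where
  m+h+2≤y+y+2 : suc (suc (m + h)) ≤ suc (suc (y + y))
  m+h+2≤y+y+2 = subst₂ _≤_ (cong suc (+-suc m h)) (cong suc (+-suc y y)) le

Kernel : Set
Kernel = ℕ → ℕ → ℕ → ℕ

_⊛_at_ : (ℕ → ℕ) → Kernel → ℕ → ℕ → ℕ
(g ⊛ K at y) k = ∑[ j ≤ y ] (g (toℕ j) * K y (toℕ j) k)

Congruent : DownStep → Set
Congruent D = ∀ last {g g′} → (∀ k → g k ≡ g′ k) → ∀ k → D last g k ≡ D last g′ k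

Intertwines : DownStep → DownStep → Kernel → Set
Intertwines D₁ D₂ K =
  ∀ last y g → (∀ j → y < j → g j ≡ 0) → ∀ k → D₂ last (g ⊛ K at y) k ≡ (D₁ last g ⊛ K at suc y) k

walks-transfer : ∀ {D₁ D₂ K} → RaisesByAtMostOne D₁ → Congruent D₂ →
                 (∀ k → K 0 0 k ≡ emptyPath 0 k) → Intertwines D₁ D₂ K →
                 ∀ m last h y → y + y ≡ m + h →
                 ∀ k → walks D₂ last h m k ≡ (walks D₁ last h m ⊛ K at y) k
walks-transfer {D₁} {D₂} {K} D₁↑ D₂-cong K₀ D₁⇒D₂ = go
  where
  go : ∀ m last h y → y + y ≡ m + h → ∀ k → walks D₂ last h m k ≡ (walks D₁ last h m ⊛ K at y) k
  go zero last zero zero _ k = sym (trans (+-identityʳ _) (trans (+-identityʳ _) (K₀ k)))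
  go zero last (suc h) y _ k =
    trans (emptyPath-off h k) (sym (∑-zero (suc y) λ j → cong (_* K y (toℕ j) k) (emptyPath-off h (toℕ j))))
  go (suc m) last zero y y+y≡ k = go m up 1 y (trans y+y≡ (sym (m+1≡1+m+0 m))) k
  go (suc m) last (suc h) (suc y) y+y≡ k = begin
    walks D₂ up (2 + h) m k + D₂ last (walks D₂ down h m) k
      ≡⟨ cong₂ _+_ (go m up (2 + h) (suc y) (trans y+y≡ (sym (+-suc m (suc h)))) k)
                   (trans (D₂-cong last (go m down h y y+y≡m+h) k)
                          (D₁⇒D₂ last y _ (walks-vanish D₁↑ m down h y (≤-reflexive (sym y+y≡m+h))) k)) ⟩
    (U ⊛ K at suc y) k + (D ⊛ K at suc y) k
      ≡⟨ ∑-factorʳ {suc (suc y)} (λ j → K (suc y) (toℕ j) k) (U ∘ toℕ) (D ∘ toℕ) ⟩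
    (walks D₁ last (suc h) (suc m) ⊛ K at suc y) k ∎
    where
    open ≡-Reasoning
    U D : ℕ → ℕ
    U = walks D₁ up (2 + h) m
    D = D₁ last (walks D₁ down h m)
    y+y≡m+h : y + y ≡ m + h
    y+y≡m+h = suc-injective (suc-injective
      (trans (cong suc (sym (+-suc y y))) (trans y+y≡ (cong suc (+-suc m h)))))

-- Dyck paths by number of peaks

peakStep : DownStep
peakStep up   = shift
peakStep down = id

narayana : Last → ℕ → ℕ → ℕ → ℕ
narayana = walks peakStep

peakStep-raises≤1 : RaisesByAtMostOne peakStep
peakStep-raises≤1 up   g y g↑ (suc j) (s≤s y<j) = g↑ j y<j
peakStep-raises≤1 down g y g↑ j       y<j       = g↑ j (<-trans (n<1+n y) y<j)

narayana-below : ∀ m h last j → m < h → narayana last h m j ≡ 0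
narayana-below zero    (suc h) last j _         = emptyPath-off h j
narayana-below (suc m) (suc h) last j (s≤s m<h) =
  cong₂ _+_ (narayana-below m (2 + h) up j (m<n⇒m<1+n (m<n⇒m<1+n m<h))) (step last j)
  where
  step : ∀ last j → peakStep last (narayana down h m) j ≡ 0
  step up   zero    = refl
  step up   (suc j) = narayana-below m h down j m<h
  step down j       = narayana-below m h down j m<h

narayana-up-peakless : ∀ m h → narayana up (suc h) m 0 ≡ 0
narayana-up-peakless zero    h = refl
narayana-up-peakless (suc m) h = trans (+-identityʳ _) (narayana-up-peakless m (suc h))

narayana-down-diagonal : ∀ h j → narayana down h h j ≡ emptyPath 0 j
narayana-down-diagonal zero    j = refl
narayana-down-diagonal (suc h) j =
  trans (cong (_+ narayana down h h j) (narayana-below h (2 + h) up j (m<n⇒m<1+n (n<1+n h))))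
        (narayana-down-diagonal h j)

narayana-up-diagonal : ∀ h j → narayana up (suc h) (suc h) (suc j) ≡ emptyPath 0 j
narayana-up-diagonal h j =
  trans (cong (_+ narayana down h h j) (narayana-below h (2 + h) up (suc j) (m<n⇒m<1+n (n<1+n h))))
        (narayana-down-diagonal h j)

-- Reflection formulas: from height h the path still has to make x + 1 up-steps and y down-steps
-- (in the second formula, x up-steps and y + 1 down-steps).
mutual
  narayana-down-reflection : ∀ m x h y j → h + suc x ≡ y → suc x + y ≡ m →
    narayana down h m j + (x C j) * (suc y C j) ≡ (suc x C j) * (y C j)
  narayana-down-reflection (suc m) x zero    y zero    refl _ = cong (_+ 1) (narayana-up-peakless m 0)
  narayana-down-reflection (suc m) x zero    y (suc j) refl e = begin
    Q + bb * ((2 + x) C (1 + j))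
      ≡⟨ cong (λ z → Q + bb * z) (pascal (suc x) j) ⟩
    Q + bb * (c + s)
      ≡⟨ solve 4 (λ Q bb c s → Q :+ bb :* (c :+ s) := (Q :+ bb :* c) :+ bb :* s) refl Q bb c s ⟩
    (Q + bb * c) + bb * s
      ≡⟨ cong (_+ bb * s) (narayana-up-reflection m x 1 x j refl (suc-injective e)) ⟩
    s * a + bb * s
      ≡⟨ solve 3 (λ s a bb → s :* a :+ bb :* s := s :* (a :+ bb)) refl s a bb ⟩
    s * (a + bb)
      ≡⟨ cong (s *_) (pascal x j) ⟨
    s * s ∎
    where
    open ≡-Reasoning
    Q a bb c s : ℕ
    Q = narayana up 1 m (suc j)
    a = x C j
    bb = x C suc j
    c = suc x C j
    s = suc x C suc j
  narayana-down-reflection (suc m) x (suc h) y zero    refl e =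
    trans (cong (λ z → z + narayana down h m 0 + 1) (narayana-up-peakless m (suc h)))
          (narayana-down-reflection m x h (h + suc x) 0 refl (suc-injective (trans (sym (+-suc (suc x) _)) e)))
  narayana-down-reflection (suc m) x (suc h) y (suc j) refl e = begin
    (U + D) + p * ((2 + y₀) C (1 + j))
      ≡⟨ cong (λ z → (U + D) + p * z) (pascal (suc y₀) j) ⟩
    (U + D) + p * (c₁ + c₂)
      ≡⟨ solve 5 (λ U D p c₁ c₂ → (U :+ D) :+ p :* (c₁ :+ c₂) := (U :+ p :* c₁) :+ (D :+ p :* c₂)) refl U D p c₁ c₂ ⟩
    (U + p * c₁) + (D + p * c₂)
      ≡⟨ cong₂ _+_ (narayana-up-reflection m x (2 + h) y₀ j (cong suc (sym (+-suc h x))) (suc-injective e))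
                   (narayana-down-reflection m x h y₀ (suc j) refl (trans (sym (+-suc x y₀)) (suc-injective e))) ⟩
    X * (y₀ C j) + X * (y₀ C suc j)
      ≡⟨ *-distribˡ-+ X _ _ ⟨
    X * ((y₀ C j) + (y₀ C suc j))
      ≡⟨ cong (X *_) (pascal y₀ j) ⟨
    X * c₂ ∎
    where
    open ≡-Reasoning
    y₀ U D p c₁ c₂ X : ℕ
    y₀ = h + suc x
    U = narayana up (2 + h) m (suc j)
    D = narayana down h m (suc j)
    p = x C suc j
    c₁ = suc y₀ C j
    c₂ = suc y₀ C suc j
    X = suc x C suc j

  narayana-up-reflection : ∀ m x h y j → h + x ≡ suc y → x + suc y ≡ m →
    narayana up h m (suc j) + (x C suc j) * (suc y C j) ≡ (suc x C suc j) * (y C j)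
  narayana-up-reflection (suc m) zero    h       y j h+0≡1+y refl =
    subst (λ h → narayana up h (suc y) (suc j) + 0 ≡ (1 C suc j) * (y C j))
          (trans (sym h+0≡1+y) (+-identityʳ h))
          (trans (cong (_+ 0) (narayana-up-diagonal y j)) (ends j))
    where
    ends : ∀ j → emptyPath 0 j + 0 ≡ (1 C suc j) * (y C j)
    ends zero    = refl
    ends (suc j) = refl
  narayana-up-reflection (suc m) (suc x) zero    y j refl e = begin
    Q + s * c
      ≡⟨ cong (λ z → Q + z * c) (pascal x j) ⟩
    Q + (a + bb) * c
      ≡⟨ solve 4 (λ Q a bb c → Q :+ (a :+ bb) :* c := (Q :+ bb :* c) :+ a :* c) refl Q a bb c ⟩
    (Q + bb * c) + a * c
      ≡⟨ cong (_+ a * c) (narayana-up-reflection m x 1 x j refl (suc-injective e)) ⟩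
    s * a + a * c
      ≡⟨ solve 3 (λ s a c → s :* a :+ a :* c := (c :+ s) :* a) refl s a c ⟩
    (c + s) * a
      ≡⟨ cong (_* a) (pascal (suc x) j) ⟨
    ((2 + x) C (1 + j)) * a ∎
    where
    open ≡-Reasoning
    Q a bb c s : ℕ
    Q = narayana up 1 m (suc j)
    a = x C j
    bb = x C suc j
    c = suc x C j
    s = suc x C suc j
  narayana-up-reflection (suc m) (suc x) (suc h) y j refl e = begin
    (U + D) + (suc x C suc j) * w
      ≡⟨ cong (λ z → (U + D) + z * w) (pascal x j) ⟩
    (U + D) + (p₁ + p₂) * w
      ≡⟨ solve 5 (λ U D p₁ p₂ w → (U :+ D) :+ (p₁ :+ p₂) :* w := (U :+ p₂ :* w) :+ (D :+ p₁ :* w)) refl U D p₁ p₂ w ⟩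
    (U + p₂ * w) + (D + p₁ * w)
      ≡⟨ cong₂ _+_ (narayana-up-reflection m x (2 + h) y j (cong suc (sym (+-suc h x))) (suc-injective e))
                   (narayana-down-reflection m x h y j refl (trans (sym (+-suc x y)) (suc-injective e))) ⟩
    X₂ * (y C j) + X₁ * (y C j)
      ≡⟨ solve 3 (λ X₁ X₂ e → X₂ :* e :+ X₁ :* e := (X₁ :+ X₂) :* e) refl X₁ X₂ (y C j) ⟩
    (X₁ + X₂) * (y C j)
      ≡⟨ cong (_* (y C j)) (pascal (suc x) j) ⟨
    ((2 + x) C (1 + j)) * (y C j) ∎
    where
    open ≡-Reasoning
    U D p₁ p₂ w X₁ X₂ : ℕ
    U = narayana up (2 + h) m (suc j)
    D = narayana down h m j
    p₁ = x C j
    p₂ = x C suc j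
    w = suc y C j
    X₁ = suc x C j
    X₂ = suc x C suc j

narayana-formula : ∀ n j → suc n * narayana up 0 (2 * suc n) (suc j) ≡ (suc n C j) * (suc n C suc j)
narayana-formula n j = +-cancelʳ-≡ (N * (c * a)) (N * Q) (a * c) (begin
  N * Q + N * (c * a)          ≡⟨ *-distribˡ-+ N Q (c * a) ⟨
  N * (Q + c * a)              ≡⟨ cong (N *_) (narayana-up-reflection (2 * N) N 0 n j refl
                                                  (cong (N +_) (sym (+-identityʳ N)))) ⟩
  N * (s * e)                  ≡⟨ solve 3 (λ N s e → N :* (s :* e) := s :* (N :* e)) refl N s e ⟩
  s * (N * e)                  ≡⟨ cong (s *_) ([1+k]*[1+n]C[1+k]≡[1+n]*nCk n j) ⟨
  s * (suc j * c)              ≡⟨ solve 3 (λ s j c → s :* (j :* c) := (j :* s) :* c) refl s (suc j) c ⟩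
  (suc j * s) * c              ≡⟨ cong (_* c) ([1+k]*[1+n]C[1+k]≡[1+n]*nCk N j) ⟩
  (suc N * a) * c              ≡⟨ solve 3 (λ N a c → (con 1 :+ N) :* a :* c := a :* c :+ N :* (c :* a)) refl N a c ⟩
  a * c + N * (c * a)          ∎)
  where
  open ≡-Reasoning
  N Q a c s e : ℕ
  N = suc n
  Q = narayana up 0 (2 * N) (suc j)
  a = N C j
  c = N C suc j
  s = suc N C suc j
  e = n C j

-- Schröder paths by number of down-steps

markStep : DownStep
markStep up   g e = g e + shift g e
markStep down     = shift

schröder : Last → ℕ → ℕ → ℕ → ℕ
schröder = walks markStep

markStep-raises≤1 : RaisesByAtMostOne markStep
markStep-raises≤1 up   g y g↑ (suc e) (s≤s y<e) =
  cong₂ _+_ (g↑ (suc e) (<-trans (n<1+n y) (s≤s y<e))) (g↑ e y<e)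
markStep-raises≤1 down g y g↑ (suc e) (s≤s y<e) = g↑ e y<e

flats : ℕ → ℕ → ℕ → ℕ
flats zero    m       e = 0
flats (suc h) zero    e = 0
flats (suc h) (suc m) e = schröder down h m e

marked : ℕ → ℕ → ℕ → ℕ
marked zero    m e = 0
marked (suc h) m e = shift (schröder down h m) e

schröder-up≡down+flats : ∀ h m e → schröder up h m e ≡ schröder down h m e + flats h m e
schröder-up≡down+flats zero    zero    e = sym (+-identityʳ _)
schröder-up≡down+flats zero    (suc m) e = sym (+-identityʳ _)
schröder-up≡down+flats (suc h) zero    e = sym (+-identityʳ _)
schröder-up≡down+flats (suc h) (suc m) e =
  solve 3 (λ u f d → u :+ (f :+ d) := u :+ d :+ f) refl
    (schröder up (2 + h) m e) (schröder down h m e) (shift (schröder down h m) e)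

-- After a down-step, an unfinished path starts with an up-step that begins no flat step, with a flat
-- step (an up-step followed by an unmarked down-step), or with a marked down-step.
schröder-down-suc : ∀ h m e →
  schröder down h (suc m) e ≡ schröder down (suc h) m e + flats (suc h) m e + marked h m e
schröder-down-suc zero    m e = trans (schröder-up≡down+flats 1 m e) (sym (+-identityʳ _))
schröder-down-suc (suc h) m e = cong (_+ shift (schröder down h m) e) (schröder-up≡down+flats (2 + h) m e)

mutual
  schröder-down-below : ∀ m h e → e < h → schröder down h m e ≡ 0
  schröder-down-below zero    (suc h) e _     = emptyPath-off h e
  schröder-down-below (suc m) (suc h) e e<1+h = trans (schröder-down-suc (suc h) m e)
    (cong₂ _+_ (cong₂ _+_ (schröder-down-below m (2 + h) e (m<n⇒m<1+n e<1+h)) (flats-below m (suc h) e e<1+h))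
               (no-marks e e<1+h))
    where
    no-marks : ∀ e → e < suc h → shift (schröder down h m) e ≡ 0
    no-marks zero    _         = refl
    no-marks (suc e) (s≤s e<h) = schröder-down-below m h e e<h

  flats-below : ∀ m h e → e < h → flats (suc h) m e ≡ 0
  flats-below zero    h e _   = refl
  flats-below (suc m) h e e<h = schröder-down-below m h e e<h

reflected : ℕ → ℕ → ℕ → ℕ
reflected e i = shift (trinomial (suc e) i)

reflected-pascal : ∀ e i a →
  reflected e i a ≡ shift (reflected e i) a + shift (λ i → reflected e i a) i + shift (trinomial e i) a
reflected-pascal e zero    zero    = refl
reflected-pascal e (suc i) zero    = refl
reflected-pascal e i       (suc a) = trinomial-pascal (suc e) i a refl

steps-nonempty : ∀ a i e {m} → a + i + i + e ≡ suc m → e + i + a ≡ suc (pred (e + i + a))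
steps-nonempty a       i       (suc e) _ = refl
steps-nonempty a       (suc i) zero    _ = refl
steps-nonempty (suc a) zero    zero    _ = refl

a+[1+i]+[1+i]+e≡2+a+i+i+e : ∀ a i e → a + suc i + suc i + e ≡ suc (suc (a + i + i + e))
a+[1+i]+[1+i]+e≡2+a+i+i+e =
  solve 3 (λ a i e → a :+ (con 1 :+ i) :+ (con 1 :+ i) :+ e := con 2 :+ (a :+ i :+ i :+ e)) refl

-- From height h there remain a up-steps, i flat steps and e marked down-steps: trinomial e i a counts
-- all their arrangements, and reflected e i a (reflection principle) those that go below height 0.
mutual
  schröder-reflection : ∀ m h a i e → h + a ≡ e → a + i + i + e ≡ m →
                        schröder down h m e + reflected e i a ≡ trinomial e i a
  schröder-reflection zero    zero    zero    zero    zero    _  _  = refl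
  schröder-reflection (suc m) h       a       i       e       e₁ e₂ = begin
    schröder down h (suc m) e + reflected e i a
      ≡⟨ cong₂ _+_ (schröder-down-suc h m e) (reflected-pascal e i a) ⟩
    (U + F + M) + (Rᵤ + Rₕ + Tᵤ)
      ≡⟨ solve 6 (λ U F M Rᵤ Rₕ Tᵤ → (U :+ F :+ M) :+ (Rᵤ :+ Rₕ :+ Tᵤ) := (U :+ Rᵤ) :+ (F :+ Rₕ) :+ (M :+ Tᵤ))
                 refl U F M Rᵤ Rₕ Tᵤ ⟩
    (U + Rᵤ) + (F + Rₕ) + (M + Tᵤ)
      ≡⟨ cong₂ _+_ (cong₂ _+_ (schröder-reflection-up m h a i e e₁ e₂)
                              (schröder-reflection-flat m h a i e e₁ e₂))
                   (schröder-reflection-down m h a i e e₁ e₂) ⟩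
    shift (trinomial e i) a + shift (λ i → trinomial e i a) i + shift (λ e → trinomial e i a) e
      ≡⟨ trinomial-pascal e i a (steps-nonempty a i e e₂) ⟨
    trinomial e i a ∎
    where
    open ≡-Reasoning
    U F M Rᵤ Rₕ Tᵤ : ℕ
    U = schröder down (suc h) m e
    F = flats (suc h) m e
    M = marked h m e
    Rᵤ = shift (reflected e i) a
    Rₕ = shift (λ i → reflected e i a) i
    Tᵤ = shift (trinomial e i) a

  schröder-reflection-up : ∀ m h a i e → h + a ≡ e → a + i + i + e ≡ suc m →
                           schröder down (suc h) m e + shift (reflected e i) a ≡ shift (trinomial e i) a
  schröder-reflection-up m h zero    i e e₁ _  =
    trans (+-identityʳ _) (schröder-down-below m (suc h) e (s≤s (≤-reflexive (trans (sym e₁) (+-identityʳ h)))))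
  schröder-reflection-up m h (suc a) i e e₁ e₂ =
    schröder-reflection m (suc h) a i e (trans (sym (+-suc h a)) e₁) (suc-injective e₂)

  schröder-reflection-flat : ∀ m h a i e → h + a ≡ e → a + i + i + e ≡ suc m →
                             flats (suc h) m e + shift (λ i → reflected e i a) i ≡ shift (λ i → trinomial e i a) i
  schröder-reflection-flat zero    h a zero    e _  _  = refl
  schröder-reflection-flat zero    h a (suc i) e _  e₂
    with () ← suc-injective (trans (sym (a+[1+i]+[1+i]+e≡2+a+i+i+e a i e)) e₂)
  schröder-reflection-flat (suc m) h a zero    e e₁ e₂ = trans (+-identityʳ _) (too-many-marks e 2+m+h≡e+e)
    where
    2+m+h≡e+e : suc (suc (m + h)) ≡ e + e
    2+m+h≡e+e = trans (cong (_+ h) (sym e₂))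
      (trans (solve 3 (λ a e h → a :+ con 0 :+ con 0 :+ e :+ h := (h :+ a) :+ e) refl a e h) (cong (_+ e) e₁))
    too-many-marks : ∀ e → suc (suc (m + h)) ≡ e + e → schröder down h m e ≡ 0
    too-many-marks (suc e) eq = walks-vanish markStep-raises≤1 m down h e
      (≤-reflexive (suc-injective (suc-injective (trans eq (cong suc (+-suc e e)))))) (suc e) ≤-refl
  schröder-reflection-flat (suc m) h a (suc i) e e₁ e₂ =
    schröder-reflection m h a i e e₁
      (suc-injective (suc-injective (trans (sym (a+[1+i]+[1+i]+e≡2+a+i+i+e a i e)) e₂)))

  schröder-reflection-down : ∀ m h a i e → h + a ≡ e → a + i + i + e ≡ suc m →
                             marked h m e + shift (trinomial e i) a ≡ shift (λ e → trinomial e i a) e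
  schröder-reflection-down m zero    a i zero    refl _  = refl
  schröder-reflection-down m zero    a i (suc e) refl _  = trinomial-sym (suc e) i e
  schröder-reflection-down m (suc h) a i (suc e) e₁   e₂ =
    schröder-reflection m h a i e (suc-injective e₁) (suc-injective (trans (sym (+-suc (a + i + i) e)) e₂))

schröder-formula : ∀ n e → e ≤ n → schröder up 0 (2 * n) e ≡ ((n + e) C (2 * e)) * catalan e
schröder-formula n e e≤n =
  subst (λ n → schröder up 0 (2 * n) e ≡ ((n + e) C (2 * e)) * catalan e) (m+[n∸m]≡n e≤n)
        (from-origin (n ∸ e))
  where
  e+e≡2*e : e + e ≡ 2 * e
  e+e≡2*e = cong (e +_) (sym (+-identityʳ e))
  from-origin : ∀ i → schröder up 0 (2 * (e + i)) e ≡ ((e + i + e) C (2 * e)) * catalan e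
  from-origin i = begin
    schröder up 0 m e                           ≡⟨ trans (schröder-up≡down+flats 0 m e) (+-identityʳ _) ⟩
    schröder down 0 m e                         ≡⟨ m+n∸n≡m (schröder down 0 m e) (reflected e i e) ⟨
    schröder down 0 m e + reflected e i e ∸ reflected e i e
      ≡⟨ cong₂ _∸_ (schröder-reflection m 0 e i e refl
                      (solve 2 (λ e i → e :+ i :+ i :+ e := con 2 :* (e :+ i)) refl e i))
                   (reflected-diagonal e) ⟩
    P * ((e + e) C e) ∸ P * ((e + e) C suc e)   ≡⟨ *-distribˡ-∸ P _ _ ⟨
    P * ((e + e) C e ∸ (e + e) C suc e)         ≡⟨ cong (P *_) (trans (cong (λ n → n C e ∸ n C suc e) e+e≡2*e)
                                                                      (sym (catalan≡ e))) ⟩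
    P * catalan e                               ≡⟨ cong (_* catalan e) P≡ ⟩
    ((e + i + e) C (2 * e)) * catalan e         ∎
    where
    open ≡-Reasoning
    m P : ℕ
    m = 2 * (e + i)
    P = (e + i + e) C i
    reflected-diagonal : ∀ e → reflected e i e ≡ ((e + i + e) C i) * ((e + e) C suc e)
    reflected-diagonal zero    = sym (*-zeroʳ ((i + 0) C i))
    reflected-diagonal (suc e) = cong₂ _*_
      (cong (_C i) (solve 2 (λ e i → con 2 :+ e :+ i :+ e := con 1 :+ e :+ i :+ (con 1 :+ e)) refl e i))
      (cong (_C suc (suc e)) (solve 1 (λ e → con 2 :+ e :+ e := con 1 :+ e :+ (con 1 :+ e)) refl e))
    P≡ : P ≡ (e + i + e) C (2 * e)
    P≡ = trans (nCk≡nC[n∸k] (≤-trans (m≤n+m i e) (m≤m+n (e + i) e)))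
               (cong ((e + i + e) C_) (trans (cong (_∸ i) (solve 2 (λ e i → e :+ i :+ e := i :+ (e :+ e)) refl e i))
                                             (trans (m+n∸m≡n i (e + e)) e+e≡2*e)))

-- Coloured Dyck paths

module Colouring (b : ℕ) where

  r : ℕ
  r = suc b

  colourStep : DownStep
  colourStep up   g k       = r * g k
  colourStep down g zero    = b * g zero
  colourStep down g (suc k) = g k + b * g (suc k)

  coloured : Last → ℕ → ℕ → ℕ → ℕ
  coloured = walks colourStep

  kind : Step r → Last
  kind u     = up
  kind (d _) = down

  completes : Step r → ℕ → ℕ → List (Step r) → Bool
  completes s h k w = dyckFrom h w ∧ (ddSameAfter s w ≡ᵇ k)

  ddSameAfter-same : ∀ (c : Fin r) w → ddSameAfter (d c) (d c ∷ w) ≡ suc (ddSameAfter (d c) w)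
  ddSameAfter-same c w with c ≟ c
  ... | yes _   = refl
  ... | no c≢c = contradiction refl c≢c

  ddSameAfter-other : ∀ {c c′ : Fin r} w → c′ ≢ c → ddSameAfter (d c) (d c′ ∷ w) ≡ ddSameAfter (d c′) w
  ddSameAfter-other {c} {c′} w c′≢c with c ≟ c′
  ... | yes c≡c′ = contradiction (sym c≡c′) c′≢c
  ... | no _     = refl

  extend : List (Step r) → List (List (Step r))
  extend w = (u ∷ w) ∷ map (λ c → d c ∷ w) (allFin r)

  count-concatMap-extend : ∀ (P : List (Step r) → Bool) ws →
    count P (concatMap extend ws) ≡ count (P ∘ (u ∷_)) ws + ∑[ c < r ] count (P ∘ (d c ∷_)) ws
  count-concatMap-extend P []       = sym (∑-zero r λ _ → refl)
  count-concatMap-extend P (w ∷ ws) = begin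
    count P (extend w ++ concatMap extend ws)
      ≡⟨ count-++ P (extend w) _ ⟩
    count P (extend w) + count P (concatMap extend ws)
      ≡⟨ cong₂ _+_ (trans (count-∷ P (u ∷ w) (map (λ c → d c ∷ w) (allFin r))) (cong (χᵤ +_) colours))
                   (count-concatMap-extend P ws) ⟩
    (χᵤ + ∑[ c < r ] χ (P (d c ∷ w))) + (count Pᵤ ws + ∑[ c < r ] count (P ∘ (d c ∷_)) ws)
      ≡⟨ interchange χᵤ (∑[ c < r ] χ (P (d c ∷ w))) (count Pᵤ ws) (∑[ c < r ] count (P ∘ (d c ∷_)) ws) ⟩
    (χᵤ + count Pᵤ ws) + (∑[ c < r ] χ (P (d c ∷ w)) + ∑[ c < r ] count (P ∘ (d c ∷_)) ws)
      ≡⟨ cong₂ _+_ (count-∷ Pᵤ w ws) (∑-distrib-+ (λ c → χ (P (d c ∷ w))) (λ c → count (P ∘ (d c ∷_)) ws)) ⟨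
    count Pᵤ (w ∷ ws) + ∑[ c < r ] (χ (P (d c ∷ w)) + count (P ∘ (d c ∷_)) ws)
      ≡⟨ cong (count Pᵤ (w ∷ ws) +_) (sum-cong-≗ {r} λ c → count-∷ (P ∘ (d c ∷_)) w ws) ⟨
    count Pᵤ (w ∷ ws) + ∑[ c < r ] count (P ∘ (d c ∷_)) (w ∷ ws) ∎
    where
    open ≡-Reasoning
    Pᵤ : List (Step r) → Bool
    Pᵤ = P ∘ (u ∷_)
    χᵤ : ℕ
    χᵤ = χ (P (u ∷ w))
    colours : count P (map (λ c → d c ∷ w) (allFin r)) ≡ ∑[ c < r ] χ (P (d c ∷ w))
    colours = trans (cong (count P) (map-tabulate id (λ c → d c ∷ w))) (count-tabulate P (λ c → d c ∷ w))

  count-completes : ∀ m (s : Step r) h k → count (completes s h k) (allWords r m) ≡ coloured (kind s) h m k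
  count-completes zero s zero    zero    = refl
  count-completes zero s zero    (suc k) = refl
  count-completes zero s (suc h) zero    = refl
  count-completes zero s (suc h) (suc k) = refl
  count-completes (suc m) s h k =
    trans (count-concatMap-extend (completes s h k) (allWords r m)) (step s h)
    where
    ws : List (List (Step r))
    ws = allWords r m
    IH : ∀ s h k → count (completes s h k) ws ≡ coloured (kind s) h m k
    IH = count-completes m
    repeated : ∀ c h k → count (λ w → completes (d c) (suc h) k (d c ∷ w)) ws ≡ shift (coloured down h m) k
    repeated c h k =
      trans (count-cong (λ w → cong (λ n → dyckFrom h w ∧ (n ≡ᵇ k)) (ddSameAfter-same c w)) ws) (go k)
      where
      go : ∀ k → count (λ w → dyckFrom h w ∧ (suc (ddSameAfter (d c) w) ≡ᵇ k)) ws
                 ≡ shift (coloured down h m) k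
      go zero    = trans (count-cong (λ w → ∧-zeroʳ (dyckFrom h w)) ws) (count-none ws)
      go (suc k) = IH (d c) h k
    other : ∀ c h k c′ → c′ ≢ c →
            count (λ w → completes (d c) (suc h) k (d c′ ∷ w)) ws ≡ coloured down h m k
    other c h k c′ c′≢c = trans
      (count-cong (λ w → cong (λ n → dyckFrom h w ∧ (n ≡ᵇ k)) (ddSameAfter-other w c′≢c)) ws) (IH (d c′) h k)
    step : ∀ s h → count (completes s h k ∘ (u ∷_)) ws + ∑[ c < r ] count (completes s h k ∘ (d c ∷_)) ws
                   ≡ coloured (kind s) h (suc m) k
    step u     zero    = trans (cong₂ _+_ (IH u 1 k) (∑-zero r λ _ → count-none ws)) (+-identityʳ _)
    step (d c) zero    = trans (cong₂ _+_ (IH u 1 k) (∑-zero r λ _ → count-none ws)) (+-identityʳ _)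
    step u     (suc h) = cong₂ _+_ (IH u (2 + h) k) (∑-const r λ c → IH (d c) h k)
    step (d c) (suc h) = cong₂ _+_ (IH u (2 + h) k)
      (trans (∑-except _ c (other c h k)) (trans (cong (_+ b * coloured down h m k) (repeated c h k)) (colourStep-down k)))
      where
      colourStep-down : ∀ k →
        shift (coloured down h m) k + b * coloured down h m k ≡ colourStep down (coloured down h m) k
      colourStep-down zero    = refl
      colourStep-down (suc k) = refl

  A≡coloured : ∀ n k → A r n k ≡ coloured up 0 (2 * n) k
  A≡coloured n k = trans (count-cong same (allWords r (2 * n))) (count-completes (2 * n) u 0 k)
    where
    same : ∀ w → (isDyck w ∧ (ddSame w ≡ᵇ k)) ≡ completes u 0 k w
    same []      = refl
    same (_ ∷ _) = refl

  colourStep-cong : Congruent colourStep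
  colourStep-cong up   g≗g′ k       = cong (r *_) (g≗g′ k)
  colourStep-cong down g≗g′ zero    = cong (b *_) (g≗g′ zero)
  colourStep-cong down g≗g′ (suc k) = cong₂ (λ x y → x + b * y) (g≗g′ k) (g≗g′ (suc k))

  colourStep-linear : ∀ last n (g : Fin n → ℕ) (F : Fin n → ℕ → ℕ) k →
    colourStep last (λ k → ∑[ j < n ] (g j * F j k)) k ≡ ∑[ j < n ] (g j * colourStep last (F j) k)
  colourStep-linear up   n g F k       = ∑-scale r g (λ j → F j k)
  colourStep-linear down n g F zero    = ∑-scale b g (λ j → F j zero)
  colourStep-linear down n g F (suc k) = trans (cong (_ +_) (∑-scale b g (λ j → F j (suc k))))
                                                (∑-factorˡ g (λ j → F j k) (λ j → b * F j (suc k)))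

  -- A path with y down-steps of which j are peaks: the j down-steps after an up-step take any of the
  -- r colours, each of the other y − j repeats its predecessor's colour or takes one of b others.
  colourings : Kernel
  colourings y j k = ((y ∸ j) C k) * r ^ j * b ^ (y ∸ j ∸ k)

  colourings₀ : ∀ k → colourings 0 0 k ≡ emptyPath 0 k
  colourings₀ zero    = refl
  colourings₀ (suc k) = refl

  colourings-up : ∀ y j k → colourings (suc y) (suc j) k ≡ colourStep up (colourings y j) k
  colourings-up y j k = solve 4 (λ c r p q → c :* (r :* p) :* q := r :* (c :* p :* q))
                                refl ((y ∸ j) C k) r (r ^ j) (b ^ (y ∸ j ∸ k))

  colourings-down : ∀ {y j} → j ≤ y → ∀ k → colourings (suc y) j k ≡ colourStep down (colourings y j) k
  colourings-down {y} {j} j≤y k rewrite +-∸-assoc 1 j≤y = go (y ∸ j) k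
    where
    p : ℕ
    p = r ^ j
    go : ∀ t k → (suc t C k) * p * b ^ (suc t ∸ k) ≡ colourStep down (λ k → (t C k) * p * b ^ (t ∸ k)) k
    go t zero    = solve 3 (λ p b q → con 1 :* p :* (b :* q) := b :* (con 1 :* p :* q)) refl p b (b ^ t)
    go t (suc k) = begin
      (suc t C suc k) * p * b ^ (t ∸ k)
        ≡⟨ cong (λ c → c * p * b ^ (t ∸ k)) (pascal t k) ⟩
      ((t C k) + (t C suc k)) * p * b ^ (t ∸ k)
        ≡⟨ solve 4 (λ c c′ p q → (c :+ c′) :* p :* q := c :* p :* q :+ p :* (c′ :* q))
                   refl (t C k) (t C suc k) p (b ^ (t ∸ k)) ⟩
      (t C k) * p * b ^ (t ∸ k) + p * ((t C suc k) * b ^ (t ∸ k))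
        ≡⟨ cong (λ x → (t C k) * p * b ^ (t ∸ k) + p * x) (nC[1+k]*x^[n∸k]≡x*nC[1+k]*x^[n∸1+k] t k b) ⟩
      (t C k) * p * b ^ (t ∸ k) + p * (b * ((t C suc k) * b ^ (t ∸ suc k)))
        ≡⟨ cong ((t C k) * p * b ^ (t ∸ k) +_)
             (solve 4 (λ p b c q → p :* (b :* (c :* q)) := b :* (c :* p :* q))
                      refl p b (t C suc k) (b ^ (t ∸ suc k))) ⟩
      (t C k) * p * b ^ (t ∸ k) + b * ((t C suc k) * p * b ^ (t ∸ suc k)) ∎
      where open ≡-Reasoning

  peaks⇒colours : Intertwines peakStep colourStep colourings
  peaks⇒colours up y g _ k = begin
    colourStep up (g ⊛ colourings at y) k
      ≡⟨ colourStep-linear up (suc y) (g ∘ toℕ) (colourings y ∘ toℕ) k ⟩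
    ∑[ j ≤ y ] (g (toℕ j) * colourStep up (colourings y (toℕ j)) k)
      ≡⟨ sum-cong-≗ {suc y} (λ j → cong (g (toℕ j) *_) (colourings-up y (toℕ j) k)) ⟨
    (shift g ⊛ colourings at suc y) k ∎
    where open ≡-Reasoning
  peaks⇒colours down y g g↑ k = begin
    colourStep down (g ⊛ colourings at y) k
      ≡⟨ colourStep-linear down (suc y) (g ∘ toℕ) (colourings y ∘ toℕ) k ⟩
    ∑[ j ≤ y ] (g (toℕ j) * colourStep down (colourings y (toℕ j)) k)
      ≡⟨ sum-cong-≗ {suc y} (λ j → cong (g (toℕ j) *_) (colourings-down (toℕ≤pred[n] j) k)) ⟨
    ∑[ j ≤ y ] (g (toℕ j) * colourings (suc y) (toℕ j) k)
      ≡⟨ ∑-dropLast y (λ j → g j * colourings (suc y) j k)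
                      (cong (_* colourings (suc y) (suc y) k) (g↑ (suc y) (n<1+n y))) ⟨
    (g ⊛ colourings at suc y) k ∎
    where open ≡-Reasoning

  coloured≡narayana⊛colourings : ∀ m last h y → y + y ≡ m + h →
    ∀ k → coloured last h m k ≡ (narayana last h m ⊛ colourings at y) k
  coloured≡narayana⊛colourings =
    walks-transfer {peakStep} {colourStep} {colourings} peakStep-raises≤1 colourStep-cong colourings₀ peaks⇒colours

  distinctStep : DownStep
  distinctStep up   g k = r * g k
  distinctStep down g k = b * g k

  coloured≡distinct : ∀ m last h → coloured last h m 0 ≡ walks distinctStep last h m 0
  coloured≡distinct zero    last h       = refl
  coloured≡distinct (suc m) last zero    = coloured≡distinct m up 1
  coloured≡distinct (suc m) up   (suc h) =
    cong₂ (λ x y → x + r * y) (coloured≡distinct m up (2 + h)) (coloured≡distinct m down h)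
  coloured≡distinct (suc m) down (suc h) =
    cong₂ (λ x y → x + b * y) (coloured≡distinct m up (2 + h)) (coloured≡distinct m down h)

  distinctStep-cong : Congruent distinctStep
  distinctStep-cong up   g≗g′ k = cong (r *_) (g≗g′ k)
  distinctStep-cong down g≗g′ k = cong (b *_) (g≗g′ k)

  -- Writing r = 1 + b, a peak either becomes a flat step (weight 1) or a marked down-step (weight b),
  -- and every other down-step is marked: a Schröder path with e marked down-steps has weight b ^ e.
  powers : Kernel
  powers _ e zero    = b ^ e
  powers _ e (suc k) = 0

  powers₀ : ∀ k → powers 0 0 k ≡ emptyPath 0 k
  powers₀ zero    = refl
  powers₀ (suc k) = refl

  powers-suc : ∀ y e k → powers y (suc e) k ≡ b * powers y e k
  powers-suc y e zero    = refl
  powers-suc y e (suc k) = sym (*-zeroʳ b)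

  marks⇒distinct : Intertwines markStep distinctStep powers
  marks⇒distinct up y g g↑ k = begin
    r * (g ⊛ powers at y) k
      ≡⟨ cong ((g ⊛ powers at y) k +_) (∑-scale {suc y} b (g ∘ toℕ) (λ j → powers y (toℕ j) k)) ⟩
    (g ⊛ powers at y) k + ∑[ e ≤ y ] (g (toℕ e) * (b * powers y (toℕ e) k))
      ≡⟨ cong₂ _+_ (∑-dropLast y (λ e → g e * powers (suc y) e k)
                                (cong (_* powers (suc y) (suc y) k) (g↑ (suc y) (n<1+n y))))
                   (sum-cong-≗ {suc y} λ e → cong (g (toℕ e) *_) (powers-suc y (toℕ e) k)) ⟨
    (g ⊛ powers at suc y) k + (shift g ⊛ powers at suc y) k
      ≡⟨ ∑-factorʳ {suc (suc y)} (λ e → powers (suc y) (toℕ e) k) (g ∘ toℕ) (shift g ∘ toℕ) ⟩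
    (markStep up g ⊛ powers at suc y) k ∎
    where open ≡-Reasoning
  marks⇒distinct down y g _ k = begin
    b * (g ⊛ powers at y) k
      ≡⟨ ∑-scale {suc y} b (g ∘ toℕ) (λ j → powers y (toℕ j) k) ⟩
    ∑[ e ≤ y ] (g (toℕ e) * (b * powers y (toℕ e) k))
      ≡⟨ sum-cong-≗ {suc y} (λ e → cong (g (toℕ e) *_) (powers-suc y (toℕ e) k)) ⟨
    (markStep down g ⊛ powers at suc y) k ∎
    where open ≡-Reasoning

  distinct≡schröder⊛powers : ∀ m last h y → y + y ≡ m + h →
    ∀ k → walks distinctStep last h m k ≡ (schröder last h m ⊛ powers at y) k
  distinct≡schröder⊛powers =
    walks-transfer {markStep} {distinctStep} {powers} markStep-raises≤1 distinctStep-cong powers₀ marks⇒distinct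

  formulaTerm : ℕ → ℕ → ℕ → ℕ
  formulaTerm n k ℓ = (n C (ℓ ∸ 1)) * (n C ℓ) * ((n ∸ ℓ) C k) * r ^ ℓ * b ^ (n ∸ ℓ ∸ k)

  formulaTerm-vanishes : ∀ n k j → n ∸ k ≤ j → j < n → formulaTerm n k (suc j) ≡ 0
  formulaTerm-vanishes n k j n∸k≤j j<n rewrite k>n⇒nCk≡0 (n∸k≤j⇒n∸[1+j]<k n k j n∸k≤j j<n) =
    cong (λ x → x * r ^ suc j * b ^ (n ∸ suc j ∸ k)) (*-zeroʳ ((n C j) * (n C suc j)))

  n*coloured≡∑formulaTerm : ∀ n k → n * coloured up 0 (2 * n) k ≡ ∑[ j < n ] formulaTerm n k (suc (toℕ j))
  n*coloured≡∑formulaTerm zero    k = refl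
  n*coloured≡∑formulaTerm (suc n) k = begin
    N * coloured up 0 (2 * N) k
      ≡⟨ cong (N *_) (coloured≡narayana⊛colourings (2 * N) up 0 N (n+n≡2*n+0 N) k) ⟩
    N * (P 0 * colourings N 0 k + ∑[ j < N ] (P (suc (toℕ j)) * colourings N (suc (toℕ j)) k))
      ≡⟨ cong (λ x → N * (x * colourings N 0 k + ∑[ j < N ] (P (suc (toℕ j)) * colourings N (suc (toℕ j)) k)))
              (narayana-up-peakless (n + suc (n + 0)) 0) ⟩
    N * ∑[ j < N ] (P (suc (toℕ j)) * colourings N (suc (toℕ j)) k)
      ≡⟨ *-distribˡ-sum {N} N (λ j → P (suc (toℕ j)) * colourings N (suc (toℕ j)) k) ⟩
    ∑[ j < N ] (N * (P (suc (toℕ j)) * colourings N (suc (toℕ j)) k))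
      ≡⟨ sum-cong-≗ {N} (λ j → term (toℕ j)) ⟩
    ∑[ j < N ] formulaTerm N k (suc (toℕ j)) ∎
    where
    open ≡-Reasoning
    N : ℕ
    N = suc n
    P : ℕ → ℕ
    P = narayana up 0 (2 * N)
    term : ∀ j → N * (P (suc j) * colourings N (suc j) k) ≡ formulaTerm N k (suc j)
    term j = begin
      N * (P (suc j) * colourings N (suc j) k)   ≡⟨ *-assoc N (P (suc j)) _ ⟨
      N * P (suc j) * colourings N (suc j) k     ≡⟨ cong (_* colourings N (suc j) k) (narayana-formula n j) ⟩
      (N C j) * (N C suc j) * colourings N (suc j) k
        ≡⟨ solve 5 (λ a b c d e → a :* b :* (c :* d :* e) := a :* b :* c :* d :* e) refl
                   (N C j) (N C suc j) ((N ∸ suc j) C k) (r ^ suc j) (b ^ (N ∸ suc j ∸ k)) ⟩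
      formulaTerm N k (suc j)                    ∎

  n*A≡nTimesFormula : ∀ n k → n * A r n k ≡ nTimesFormula r n k
  n*A≡nTimesFormula n k = begin
    n * A r n k
      ≡⟨ cong (n *_) (A≡coloured n k) ⟩
    n * coloured up 0 (2 * n) k
      ≡⟨ n*coloured≡∑formulaTerm n k ⟩
    ∑[ j < n ] formulaTerm n k (suc (toℕ j))
      ≡⟨ ∑-truncate (formulaTerm n k ∘ suc) (m∸n≤m n k) (formulaTerm-vanishes n k) ⟩
    ∑[ j < n ∸ k ] formulaTerm n k (suc (toℕ j))
      ≡⟨ sum-map-applyUpTo (formulaTerm n k) suc (n ∸ k) ⟨
    nTimesFormula r n k ∎
    where open ≡-Reasoning

  A-without-repeats≡S : ∀ n → A r n 0 ≡ S n 1 b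
  A-without-repeats≡S n = begin
    A r n 0                                   ≡⟨ A≡coloured n 0 ⟩
    coloured up 0 (2 * n) 0                   ≡⟨ coloured≡distinct (2 * n) up 0 ⟩
    walks distinctStep up 0 (2 * n) 0         ≡⟨ distinct≡schröder⊛powers (2 * n) up 0 n (n+n≡2*n+0 n) 0 ⟩
    ∑[ e ≤ n ] (schröder up 0 (2 * n) (toℕ e) * b ^ toℕ e)
      ≡⟨ sum-cong-≗ {suc n} (λ e → cong (_* b ^ toℕ e) (trans (schröder-formula n (toℕ e) (toℕ≤pred[n] e))
                                                              (sym (times-1^ (n ∸ toℕ e))))) ⟩
    ∑[ e ≤ n ] (((n + toℕ e) C (2 * toℕ e)) * catalan (toℕ e) * 1 ^ (n ∸ toℕ e) * b ^ toℕ e)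
      ≡⟨ sum-map-applyUpTo _ id (suc n) ⟨
    S n 1 b ∎
    where
    open ≡-Reasoning
    times-1^ : ∀ {x} t → x * 1 ^ t ≡ x
    times-1^ {x} t = trans (cong (x *_) (^-zeroˡ t)) (*-identityʳ x)

theorem2p1 : (r n k : ℕ) → 1 ≤ r → 1 ≤ n → k ≤ n →
    (n * A r n k ≡ nTimesFormula r n k)
    × (A r n 0 ≡ S n 1 (r Data.Nat.∸ 1))
    × (A 2 n 0 ≡ S n 1 1)
theorem2p1 (suc b) n k _ _ _ =
  Colouring.n*A≡nTimesFormula b n k , Colouring.A-without-repeats≡S b n , Colouring.A-without-repeats≡S 1 n
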